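{- An algorithm that solves the MIS problem cannot terminate with a correct solution in every execution.
   Context: Nodes of an undirected graph are anonymous, start in identical states, and run the same randomized algorithm in synchronous rounds in the beeping model: in each round a node either beeps or listens, a listening node learns only whether at least one neighbor beeped, and a beeping node gets no feedback. This holds even if nodes wake up at the same time and know the network size. Solving the MIS problem means that the set of nodes that output "in MIS" is a maximal independent set of the graph. -}

module Defs where

open import Data.Nat using (ℕ; zero; suc; _<_)
open import Data.Fin using (Fin)
open import Data.Bool using (Bool; true; false; _∧_; if_then_else_)
open import Data.List using (allFin)
open import Data.Bool.ListAction using (any)
open import Data.Maybe using (Maybe; just; nothing)
open import Data.Product using (Σ; _×_; ∃)
open import Data.Empty using (⊥)
open import Relation.Binary.PropositionalEquality using (_≡_)

-- A finite simple undirected graph on the anonymous nodes Fin n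
-- (node names are only used by the analysis, never by the algorithm).
record Graph (n : ℕ) : Set where
  field
    adj   : Fin n → Fin n → Bool
    sym   : ∀ u v → adj u v ≡ adj v u
    irrefl : ∀ v → adj v v ≡ false

-- A randomized beeping algorithm, identical at every node.
-- Randomness: each node owns an infinite string of random bits (ℕ → Bool),
-- from which its (common) initial state is built; afterwards the algorithm
-- is a deterministic state machine.
--   beep s      : in state s the node beeps (true) or listens (false)
--   stepBeep s  : next state after beeping (no feedback)
--   stepListen s h : next state after listening, h = "some neighbour beeped"
--   output s    : nothing = not yet terminated, just b = terminated, b = "in MIS"
record Algorithm : Set₁ where
  field
    State      : Set
    init       : (ℕ → Bool) → State
    beep       : State → Bool
    stepBeep   : State → State
    stepListen : State → Bool → State
    output     : State → Maybe Bool

module Execution {n : ℕ} (A : Algorithm) (G : Graph n) (ρ : Fin n → ℕ → Bool) where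
  open Algorithm A
  open Graph G

  -- state of every node at the beginning of round t (synchronous wake-up)
  state : ℕ → Fin n → State
  heard : ℕ → Fin n → Bool
  state zero    v = init (ρ v)
  state (suc t) v = if beep (state t v) then stepBeep (state t v)
                                         else stepListen (state t v) (heard t v)
  heard t v = any (λ u → adj v u ∧ beep (state t u)) (allFin n)

  DecidesAt : Fin n → ℕ → Bool → Set
  DecidesAt v t b = (output (state t v) ≡ just b) × (∀ t' → t' < t → output (state t' v) ≡ nothing)

IsMIS : {n : ℕ} → Graph n → (Fin n → Bool) → Set
IsMIS G inMIS =
  (∀ u v → adj u v ≡ true → inMIS u ≡ true → inMIS v ≡ true → ⊥) ×
  (∀ v → inMIS v ≡ false → ∃ λ u → (adj v u ≡ true) × (inMIS u ≡ true))
  where open Graph G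

TerminatesCorrectly : {n : ℕ} → Algorithm → Graph n → (Fin n → ℕ → Bool) → Set
TerminatesCorrectly {n} A G ρ =
  Σ (Fin n → Bool) λ inMIS → (∀ v → ∃ λ t → DecidesAt v t (inMIS v)) × IsMIS G inMIS
  where open Execution A G ρ

module Submission where

-- Proof idea (symmetry breaking is impossible).  Run the algorithm for network
-- size 2 on the single-edge graph K₂ and give both nodes the same random bit
-- string.  The two nodes then start in the same state and receive the same
-- feedback in every round, so by induction on the round their states coincide
-- forever.  A node's decision is its first defined output, hence unique, and
-- the two nodes therefore output the same bit.  But in any maximal independent
-- set, the endpoints u, v of an edge whose endpoint v has no other neighbour
-- receive different labels: both "in" violates independence, both "out"
-- leaves v without a neighbour in the set.  So this execution is incorrect.

open import Defs
open import Data.Nat using (ℕ; zero; suc)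
open import Data.Nat.Properties using (<-cmp)
open import Data.Fin using (Fin; zero; suc)
open import Data.Bool using (Bool; true; false; _∨_; if_then_else_)
open import Data.Maybe.Properties using (just-injective)
open import Data.Product using (_,_)
open import Relation.Nullary using (¬_)
open import Relation.Binary using (tri<; tri≈; tri>)
open import Relation.Binary.PropositionalEquality

module Decisions {n : ℕ} (A : Algorithm) (G : Graph n) (ρ : Fin n → ℕ → Bool) where
  open Algorithm A
  open Execution A G ρ

  -- A node decides at most one value: its decision is its first defined output,
  -- so two decision times can only coincide.
  decision-unique : ∀ {v t t' b b'} → DecidesAt v t b → DecidesAt v t' b' → b ≡ b'
  decision-unique {t = t} {t'} (out , before) (out' , before') with <-cmp t t'
  ... | tri< t<t' _ _ with () ← trans (sym out) (before' t t<t')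
  ... | tri≈ _ refl _ = just-injective (trans (sym out) out')
  ... | tri> _ _ t'<t with () ← trans (sym out') (before t' t'<t)

  decision-transfer : ∀ {u v t b} → (∀ r → state r u ≡ state r v) →
                      DecidesAt u t b → DecidesAt v t b
  decision-transfer {t = t} same (out , before) =
    trans (cong output (sym (same t))) out ,
    λ r r<t → trans (cong output (sym (same r))) (before r r<t)

pendant-edge-split : ∀ {n} (G : Graph n) {inMIS : Fin n → Bool} {u v : Fin n} →
                     Graph.adj G u v ≡ true →
                     (∀ w → Graph.adj G v w ≡ true → w ≡ u) →
                     IsMIS G inMIS → inMIS u ≢ inMIS v
-- Case on u's label; the abstraction turns `same` into  label ≡ inMIS v.
pendant-edge-split G {inMIS} {u} {v} uv only-u (independent , maximal) same
  with inMIS u in eq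
... | true  = independent u v uv eq (sym same)
... | false with maximal v (sym same)
...   | w , vw , w-in with only-u w vw
...     | refl with () ← trans (sym w-in) eq

k₂-adj : Fin 2 → Fin 2 → Bool
k₂-adj zero       (suc zero) = true
k₂-adj (suc zero) zero       = true
k₂-adj _          _          = false

K₂ : Graph 2
K₂ = record { adj = k₂-adj ; sym = adj-sym ; irrefl = adj-irrefl }
  where
  adj-sym : ∀ u v → k₂-adj u v ≡ k₂-adj v u
  adj-sym zero       zero       = refl
  adj-sym zero       (suc zero) = refl
  adj-sym (suc zero) zero       = refl
  adj-sym (suc zero) (suc zero) = refl

  adj-irrefl : ∀ v → k₂-adj v v ≡ false
  adj-irrefl zero       = refl
  adj-irrefl (suc zero) = refl

k₂-pendant : ∀ w → k₂-adj (suc zero) w ≡ true → w ≡ zero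
k₂-pendant zero       _  = refl
k₂-pendant (suc zero) ()

-- With identical random strings the two nodes of K₂ evolve in lock-step: each
-- hears exactly the other's beep, so equal states yield equal feedback.
k₂-lock-step : (A : Algorithm) (r : ℕ → Bool) →
               let open Execution A K₂ (λ _ → r) in
               ∀ t → state t zero ≡ state t (suc zero)
k₂-lock-step A r zero    = refl
k₂-lock-step A r (suc t) =
  cong₂ (λ s h → if beep s then stepBeep s else stepListen s h)
        (k₂-lock-step A r t)
        (cong (λ s → beep s ∨ false) (sym (k₂-lock-step A r t)))
  where open Algorithm A

lemma2 : (A : ℕ → Algorithm) →
    ¬ (∀ (n : ℕ) (G : Graph n) (ρ : Fin n → ℕ → Bool) → TerminatesCorrectly (A n) G ρ)
lemma2 A correct with correct 2 K₂ (λ _ _ → false)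
... | inMIS , decides , mis with decides zero | decides (suc zero)
... | _ , d₀ | _ , d₁ =
  pendant-edge-split K₂ refl k₂-pendant mis
    (decision-unique (decision-transfer (k₂-lock-step (A 2) (λ _ → false)) d₀) d₁)
  where open Decisions (A 2) K₂ (λ _ _ → false)
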